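{- Let $(D,\mathbb{T})$ be a symmetric trip network. For any node $u$, there exists a schedule $S$ of $(D,\mathbb{T})$ such that for every node $v$ from which $u$ is reachable in $D$ (via a walk), $u$ is $S$-reachable from $v$.
   Context: A weighted multidigraph $D=(V,E)$ has a finite node set $V$ and a finite multiset $E$ of edges $(u,v,w)$ with weight $w>0$. A trip network is a pair $(D,\mathbb{T})$ where $\mathbb{T}$ is a finite multiset of walks in $D$ (trips); every node and edge of $D$ appears in some trip. The duration $\delta(T)$ of a trip is the sum of its edge weights. A temporalisation $\tau$ assigns a real starting time $\tau(T)$ to each trip. For a trip $T=e_1,\dots,e_k$ with $e_i=(u_i,v_i,w_i)$, it induces temporal edges $(u_i,v_i,\tau(T)+\sum_{j<i}w_j,w_i)$ (tail, head, starting time, travel time). The induced temporal graph $G[D,\mathbb{T},\tau]$ has node set $V$ and all temporal edges induced by all trips. A temporal path from $u$ to $v$ is a sequence of consecutive temporal edges from $u$ to $v$ in which each edge's starting time is at least the arrival time (starting time plus travel time) of the previous one; $v$ is $\tau$-reachable from $u$ if such a path exists (every node reaches itself). A schedule $S$ is an ordering $T_1,\dots,T_{|\mathbb{T}|}$ of the trips; it induces the temporalisation $\tau_S(T_1)=0$, $\tau_S(T_{i+1})=\sum_{j=1}^{i}\delta(T_j)$; $v$ is $S$-reachable from $u$ if it is $\tau_S$-reachable. A trip network is symmetric if its trips can be grouped into disjoint pairs $(T,\overline{T})$ of two distinct members of $\mathbb{T}$ where $\overline{T}$ is the reverse of $T$, visiting the same nodes in reverse order.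
   Formalization: The edge weights of the trip network, and the starting times of trips and temporal edges, are rationals instead of reals. -}

module Defs where

open import Data.Nat using (ℕ)
open import Data.Fin using (Fin; zero; suc)
open import Data.Rational using (ℚ; 0ℚ; _+_; _≤_; _<_)
open import Data.List using (List; []; _∷_; map; reverse; concatMap; foldr; allFin)
open import Data.List.Membership.Propositional using (_∈_)
open import Data.List.Relation.Unary.All using (All)
open import Data.Fin.Permutation using (Permutation; _⟨$⟩ʳ_; _⟨$⟩ˡ_)
open import Data.Product using (Σ; ∃; _×_; _,_)
open import Relation.Binary.PropositionalEquality using (_≡_; _≢_)
open import Relation.Nullary using (¬_)
open import Function using (_∘_)

record Edge (n : ℕ) : Set where
  constructor edge
  field
    tl  : Fin n
    hd  : Fin n
    wt  : ℚ
open Edge public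

data IsWalk {n : ℕ} : List (Edge n) → Set where
  walk-one  : ∀ e → IsWalk (e ∷ [])
  walk-cons : ∀ e f es → hd e ≡ tl f → IsWalk (f ∷ es) → IsWalk (e ∷ f ∷ es)

nodes : ∀ {n} → List (Edge n) → List (Fin n)
nodes []       = []
nodes (e ∷ es) = tl e ∷ map hd (e ∷ es)

duration : ∀ {n} → List (Edge n) → ℚ
duration es = foldr (λ e acc → wt e + acc) 0ℚ es

record TripNetwork (n : ℕ) : Set where
  field
    E        : List (Edge n)
    m        : ℕ
    trip     : Fin m → List (Edge n)
    wt-pos   : All (λ e → 0ℚ < wt e) E
    trip-walk : ∀ i → IsWalk (trip i)
    trip-in-E : ∀ i → All (_∈ E) (trip i)
    node-cov : ∀ (v : Fin n) → ∃ λ i → v ∈ nodes (trip i)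
    edge-cov : All (λ e → ∃ λ i → e ∈ trip i) E
open TripNetwork public

-- Symmetric: trips grouped into disjoint pairs (T, T̄) of distinct members,
-- T̄ visiting the nodes of T in reverse order (fixed-point-free involution).
Symmetric : ∀ {n} → TripNetwork n → Set
Symmetric N = Σ (Fin (m N) → Fin (m N)) λ σ →
  (∀ i → σ (σ i) ≡ i) ×
  (∀ i → σ i ≢ i) ×
  (∀ i → nodes (trip N (σ i)) ≡ reverse (nodes (trip N i)))

data DReach {n} (N : TripNetwork n) : Fin n → Fin n → Set where
  d-refl : ∀ {u} → DReach N u u
  d-step : ∀ {u v e} → DReach N u (tl e) → e ∈ E N → hd e ≡ v → DReach N u v

record TEdge (n : ℕ) : Set where
  constructor tedge
  field
    ttl   : Fin n
    thd   : Fin n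
    start : ℚ
    trav  : ℚ
open TEdge public

tripTEdges : ∀ {n} → ℚ → List (Edge n) → List (TEdge n)
tripTEdges s []       = []
tripTEdges s (e ∷ es) = tedge (tl e) (hd e) s (wt e) ∷ tripTEdges (s + wt e) es

Temporalisation : ∀ {n} → TripNetwork n → Set
Temporalisation N = Fin (m N) → ℚ

induced : ∀ {n} (N : TripNetwork n) → Temporalisation N → List (TEdge n)
induced N τ = concatMap (λ i → tripTEdges (τ i) (trip N i)) (allFin (m N))

-- TPath G t u v : a temporal path in G from u to v whose first edge starts
-- at time ≥ t (the empty path witnesses that every node reaches itself).
data TPath {n} (G : List (TEdge n)) : ℚ → Fin n → Fin n → Set where
  t-done : ∀ {t v} → TPath G t v v
  t-step : ∀ {t u v} (e : TEdge n) → e ∈ G → ttl e ≡ u → t ≤ start e →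
           TPath G (start e + trav e) (thd e) v → TPath G t u v

TReach : ∀ {n} (N : TripNetwork n) → Temporalisation N → Fin n → Fin n → Set
TReach N τ u v = Σ ℚ λ t → TPath (induced N τ) t u v

-- A schedule: an ordering of the trips, given as a permutation
-- (position ↦ trip).
Schedule : ∀ {n} → TripNetwork n → Set
Schedule N = Permutation (m N) (m N)

prefixSum : ∀ {k} → (Fin k → ℚ) → Fin k → ℚ
prefixSum f zero    = 0ℚ
prefixSum f (suc p) = f zero + prefixSum (f ∘ suc) p

τS : ∀ {n} (N : TripNetwork n) → Schedule N → Temporalisation N
τS N S T = prefixSum (λ p → duration (trip N (S ⟨$⟩ʳ p))) (S ⟨$⟩ˡ T)

SReach : ∀ {n} (N : TripNetwork n) → Schedule N → Fin n → Fin n → Set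
SReach N S u v = TReach N (τS N S) u v

{-# OPTIONS --safe #-}
module Submission where

-- Call two trips adjacent when they share a node.  Stage 0 consists of the
-- trips through u, stage l + 1 adds the trips adjacent to a trip of stage l;
-- the stages are subsets of the m trips, so they saturate after m + 1 steps.
-- Schedule the trips by decreasing entry stage.  A trip i entering at stage
-- l + 1 meets a trip j of stage l at some node y.  From any stop x of i, one of
-- i and its reverse σ i carries x to y, and both end before j and σ j start.
-- So, by induction on the stage, every stop of a saturated-stage trip reaches
-- u, and every v that reaches u in D is such a stop, as every edge lies on a
-- trip.

open import Defs
open import Data.Nat using (ℕ)
open import Data.Fin using (Fin)
open import Data.Product using (Σ)

open import Data.Nat as ℕ using (zero; suc; z≤n; s≤s)
import Data.Nat.Properties as ℕP
open import Data.Fin as F using (zero; suc; toℕ; fromℕ<)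
import Data.Fin.Properties as FP
open import Data.Fin.Subset using (Subset; ∣_∣)
  renaming (_∈_ to _∈ₛ_; _∉_ to _∉ₛ_; _⊆_ to _⊆ₛ_; _⊂_ to _⊂ₛ_)
open import Data.Fin.Subset.Properties using (∣p∣≤n; p⊂q⇒∣p∣<∣q∣; ⊆-antisym)
  renaming (_∈?_ to _∈ₛ?_; _⊂?_ to _⊂ₛ?_)
open import Data.Fin.Permutation as Perm
  using (Permutation; _⟨$⟩ʳ_; _⟨$⟩ˡ_; _∘ₚ_; lift₀; transpose; inverseʳ)
open import Data.Rational using (ℚ; 0ℚ; _+_; _≤_)
import Data.Rational.Properties as QP
open import Data.List using (List; []; _∷_; _++_; [_]; _∷ʳ_; reverse; allFin)
open import Data.List.Properties using (unfold-reverse)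
open import Data.List.Relation.Unary.Any using (Any; here; there; any?)
open import Data.List.Relation.Unary.Any.Properties using (reverse⁺; reverse⁻)
open import Data.List.Relation.Unary.All as All using (All; []; _∷_)
open import Data.List.Membership.Propositional using (_∈_; find; lose)
open import Data.List.Membership.Propositional.Properties
  using (∈-++⁺ˡ; ∈-++⁺ʳ; ∈-map⁺; ∈-allFin; ∈-concatMap⁺)
open import Data.List.Relation.Binary.Subset.Propositional using (_⊆_)
open import Data.List.Relation.Binary.Subset.Propositional.Properties using (Any-resp-⊆)
open import Data.List.Extrema.Nat using (argmax; f[xs]≤f[argmax])
open import Data.Vec using (tabulate)
open import Data.Vec.Properties using ([]=⇒lookup; lookup⇒[]=; lookup∘tabulate)
open import Data.Product using (∃; _×_; _,_; proj₁; proj₂)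
open import Data.Sum using (_⊎_; inj₁; inj₂)
open import Data.Empty using (⊥-elim)
open import Relation.Nullary using (¬_; Dec; yes; no; does; ¬?)
open import Relation.Nullary.Decidable using (_×-dec_; _⊎-dec_; dec-true)
open import Relation.Binary.PropositionalEquality
  using (_≡_; refl; sym; trans; cong; subst; subst₂)
open import Function using (_∘_; id)

p≤p+q : ∀ p {q} → 0ℚ ≤ q → p ≤ p + q
p≤p+q p 0≤q = subst (_≤ p + _) (QP.+-identityʳ p) (QP.+-monoʳ-≤ p 0≤q)

duration-nonneg : ∀ {n} {es : List (Edge n)} → All (λ e → 0ℚ ≤ wt e) es →
                  0ℚ ≤ duration es
duration-nonneg []           = QP.≤-refl
duration-nonneg (0≤e ∷ 0≤es) = QP.≤-trans 0≤e (p≤p+q _ (duration-nonneg 0≤es))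

prefixSum-nonneg : ∀ {k} {f : Fin k → ℚ} → (∀ p → 0ℚ ≤ f p) →
                   ∀ p → 0ℚ ≤ prefixSum f p
prefixSum-nonneg 0≤f zero    = QP.≤-refl
prefixSum-nonneg 0≤f (suc p) =
  QP.≤-trans (0≤f zero) (p≤p+q _ (prefixSum-nonneg (0≤f ∘ suc) p))

prefixSum-< : ∀ {k} {f : Fin k → ℚ} → (∀ p → 0ℚ ≤ f p) →
              ∀ {p q} → p F.< q → prefixSum f p + f p ≤ prefixSum f q
prefixSum-< {f = f} 0≤f {zero} {suc q} _ = begin
  0ℚ + f zero                    ≡⟨ QP.+-identityˡ (f zero) ⟩
  f zero                         ≤⟨ p≤p+q (f zero) (prefixSum-nonneg (0≤f ∘ suc) q) ⟩
  f zero + prefixSum (f ∘ suc) q ∎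
  where open QP.≤-Reasoning
prefixSum-< {f = f} 0≤f {suc p} {suc q} (s≤s p<q) = begin
  f zero + prefixSum (f ∘ suc) p + f (suc p)   ≡⟨ QP.+-assoc (f zero) _ _ ⟩
  f zero + (prefixSum (f ∘ suc) p + f (suc p)) ≤⟨ QP.+-monoʳ-≤ (f zero)
                                                    (prefixSum-< (0≤f ∘ suc) p<q) ⟩
  f zero + prefixSum (f ∘ suc) q               ∎
  where open QP.≤-Reasoning

argmax-Fin : ∀ {k} (f : Fin (suc k) → ℕ) → ∃ λ i → ∀ j → f j ℕ.≤ f i
argmax-Fin {k} f = argmax f zero (allFin (suc k)) , λ j →
  All.lookup (f[xs]≤f[argmax] {f = f} zero (allFin (suc k))) (∈-allFin j)

SortedDescending : ∀ {k} → (Fin k → ℕ) → Permutation k k → Set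
SortedDescending f S = ∀ {p q} → p F.≤ q → f (S ⟨$⟩ʳ q) ℕ.≤ f (S ⟨$⟩ʳ p)

sortDescending : ∀ {k} (f : Fin k → ℕ) → Σ (Permutation k k) (SortedDescending f)
sortDescending {zero}  f = Perm.id , λ {p} → ⊥-elim (FP.¬Fin0 p)
sortDescending {suc k} f = lift₀ rest ∘ₚ transpose zero top , sorted
  where
  top : Fin (suc k)
  top = proj₁ (argmax-Fin f)
  f′ : Fin k → ℕ
  f′ j = f (transpose zero top ⟨$⟩ʳ suc j)
  rest : Permutation k k
  rest = proj₁ (sortDescending f′)
  sorted : SortedDescending f (lift₀ rest ∘ₚ transpose zero top)
  sorted {zero}  {q}     _         = proj₂ (argmax-Fin f) _
  sorted {suc p} {suc q} (s≤s p≤q) = proj₂ (sortDescending f′) p≤q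

larger-first : ∀ {k} {f : Fin k → ℕ} {S : Permutation k k} → SortedDescending f S →
               ∀ {i j} → f j ℕ.< f i → S ⟨$⟩ˡ i F.< S ⟨$⟩ˡ j
larger-first {f = f} {S} sorted {i} {j} fj<fi = ℕP.≰⇒> not-after
  where
  not-after : ¬ (S ⟨$⟩ˡ j F.≤ S ⟨$⟩ˡ i)
  not-after j≤i = ℕP.<⇒≱ fj<fi
    (subst₂ ℕ._≤_ (cong f (inverseʳ S)) (cong f (inverseʳ S)) (sorted j≤i))

data Precedes {A : Set} : List A → A → A → Set where
  first : ∀ {x y xs} → y ∈ x ∷ xs → Precedes (x ∷ xs) x y
  later : ∀ {z x y xs} → Precedes xs x y → Precedes (z ∷ xs) x y

module _ {A : Set} where

  precedes-++ : ∀ {x y : A} {xs} ys → Precedes xs x y → Precedes (xs ++ ys) x y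
  precedes-++ ys (first y∈)  = first (∈-++⁺ˡ y∈)
  precedes-++ ys (later x≼y) = later (precedes-++ ys x≼y)

  precedes-∷ʳ : ∀ {x y : A} {xs} → x ∈ xs → Precedes (xs ∷ʳ y) x y
  precedes-∷ʳ {xs = _ ∷ xs} (here refl) = first (there (∈-++⁺ʳ xs (here refl)))
  precedes-∷ʳ (there x∈)               = later (precedes-∷ʳ x∈)

  precedes-or-reverse : ∀ {x y : A} {xs} → x ∈ xs → y ∈ xs →
                        Precedes xs x y ⊎ Precedes (reverse xs) x y
  precedes-or-reverse (here refl) y∈ = inj₁ (first y∈)
  precedes-or-reverse {xs = z ∷ xs} (there x∈) (here refl) =
    inj₂ (subst (λ zs → Precedes zs _ z) (sym (unfold-reverse z xs))
                (precedes-∷ʳ (reverse⁺ x∈)))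
  precedes-or-reverse {xs = z ∷ xs} (there x∈) (there y∈)
    with precedes-or-reverse x∈ y∈
  ... | inj₁ x≼y = inj₁ (later x≼y)
  ... | inj₂ x≼y = inj₂ (subst (λ zs → Precedes zs _ _) (sym (unfold-reverse z xs))
                               (precedes-++ [ z ] x≼y))

hd∈nodes : ∀ {n} {e : Edge n} {es} → e ∈ es → hd e ∈ nodes es
hd∈nodes {es = _ ∷ _} e∈ = there (∈-map⁺ hd e∈)

tl∈nodes : ∀ {n} {e : Edge n} {es} → IsWalk es → e ∈ es → tl e ∈ nodes es
tl∈nodes (walk-one _)               (here refl) = here refl
tl∈nodes (walk-cons _ _ _ _ _)      (here refl) = here refl
tl∈nodes (walk-cons _ _ _ hd≡tl w) (there e∈) with tl∈nodes w e∈
... | here tl≡  = there (here (trans tl≡ (sym hd≡tl)))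
... | there tl∈ = there (there tl∈)

module _ {n} (G : List (TEdge n)) where

  wait : ∀ {t t′ x v} → t ≤ t′ → TPath G t′ x v → TPath G t x v
  wait t≤t′ t-done                   = t-done
  wait t≤t′ (t-step e e∈ tl≡ t′≤ p) = t-step e e∈ tl≡ (QP.≤-trans t≤t′ t′≤) p

  board : ∀ {s e v} → tedge (tl e) (hd e) s (wt e) ∈ G →
          TPath G (s + wt e) (hd e) v → TPath G s (tl e) v
  board e∈ = t-step _ e∈ refl QP.≤-refl

  ride : ∀ {es s x y v} → IsWalk es → All (λ e → 0ℚ ≤ wt e) es → tripTEdges s es ⊆ G →
         Precedes (nodes es) x y → TPath G (s + duration es) y v → TPath G s x v
  ride {s = s} (walk-one _) 0≤es _ (first (here refl)) =
    wait (p≤p+q s (duration-nonneg 0≤es))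
  ride {s = s} (walk-one e) _ ⊆G (first (there (here refl))) =
    board (⊆G (here refl)) ∘ wait (QP.≤-reflexive (cong (s +_) (sym (QP.+-identityʳ (wt e)))))
  ride {s = s} (walk-one _) 0≤es _ (later (first (here refl))) =
    wait (p≤p+q s (duration-nonneg 0≤es))
  ride {s = s} (walk-cons _ _ _ refl _) 0≤es _ (first (here refl)) =
    wait (p≤p+q s (duration-nonneg 0≤es))
  ride {s = s} (walk-cons e _ _ refl w) (_ ∷ 0≤es) ⊆G (first (there y∈)) =
    board (⊆G (here refl)) ∘ ride w 0≤es (⊆G ∘ there) (first y∈) ∘
    wait (QP.≤-reflexive (QP.+-assoc s (wt e) _))
  ride {s = s} (walk-cons e _ _ refl w) (0≤e ∷ 0≤es) ⊆G (later x≼y) =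
    wait (p≤p+q s 0≤e) ∘ ride w 0≤es (⊆G ∘ there) x≼y ∘
    wait (QP.≤-reflexive (QP.+-assoc s (wt e) _))

module _ {n} (N : TripNetwork n) where

  trip-weights-nonneg : ∀ i → All (λ e → 0ℚ ≤ wt e) (trip N i)
  trip-weights-nonneg i =
    All.map (λ e∈E → QP.<⇒≤ (All.lookup (wt-pos N) e∈E)) (trip-in-E N i)

  trip-⊆-induced : ∀ (τ : Temporalisation N) i → tripTEdges (τ i) (trip N i) ⊆ induced N τ
  trip-⊆-induced τ i te∈ =
    ∈-concatMap⁺ (λ j → tripTEdges (τ j) (trip N j)) (lose (∈-allFin i) te∈)

  ride-trip : ∀ (τ : Temporalisation N) i {x y v} → Precedes (nodes (trip N i)) x y →
              TPath (induced N τ) (τ i + duration (trip N i)) y v →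
              TPath (induced N τ) (τ i) x v
  ride-trip τ i = ride _ (trip-walk N i) (trip-weights-nonneg i) (trip-⊆-induced τ i)

  scheduled-durations-nonneg : ∀ (S : Schedule N) p → 0ℚ ≤ duration (trip N (S ⟨$⟩ʳ p))
  scheduled-durations-nonneg S p = duration-nonneg (trip-weights-nonneg (S ⟨$⟩ʳ p))

  τS-nonneg : ∀ (S : Schedule N) i → 0ℚ ≤ τS N S i
  τS-nonneg S i = prefixSum-nonneg (scheduled-durations-nonneg S) (S ⟨$⟩ˡ i)

  finish≤start : ∀ (S : Schedule N) {i j} → S ⟨$⟩ˡ i F.< S ⟨$⟩ˡ j →
                 τS N S i + duration (trip N i) ≤ τS N S j
  finish≤start S {i} {j} i<j =
    subst (λ i′ → τS N S i + duration (trip N i′) ≤ τS N S j) (inverseʳ S)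
      (prefixSum-< (scheduled-durations-nonneg S) i<j)

module _ {k} {P : Fin k → Set} (P? : ∀ i → Dec (P i)) where

  fromDec : Subset k
  fromDec = tabulate (does ∘ P?)

  ∈-fromDec⁺ : ∀ {i} → P i → i ∈ₛ fromDec
  ∈-fromDec⁺ {i} p =
    lookup⇒[]= i fromDec (trans (lookup∘tabulate (does ∘ P?) i) (dec-true (P? i) p))

  ∈-fromDec⁻ : ∀ {i} → i ∈ₛ fromDec → P i
  ∈-fromDec⁻ {i} i∈ with P? i | trans (sym (lookup∘tabulate (does ∘ P?) i)) ([]=⇒lookup i∈)
  ... | yes p | _ = p
  ... | no _  | ()

⊆∧⊄⇒⊇ : ∀ {k} {p q : Subset k} → p ⊆ₛ q → ¬ p ⊂ₛ q → q ⊆ₛ p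
⊆∧⊄⇒⊇ {p = p} p⊆q p⊄q {x} x∈q with x ∈ₛ? p
... | yes x∈p = x∈p
... | no x∉p  = ⊥-elim (p⊄q (p⊆q , x , x∈q , x∉p))

module Saturation {k} (grow : Subset k → Subset k) (grow-inflationary : ∀ p → p ⊆ₛ grow p)
                  (initial : Subset k) where

  stage : ℕ → Subset k
  stage zero    = initial
  stage (suc l) = grow (stage l)

  stage-mono : ∀ {j l} → j ℕ.≤ l → stage j ⊆ₛ stage l
  stage-mono {l = zero}  z≤n = id
  stage-mono {l = suc l} j≤1+l with ℕP.m≤n⇒m<n∨m≡n j≤1+l
  ... | inj₁ (s≤s j≤l) = grow-inflationary _ ∘ stage-mono j≤l
  ... | inj₂ refl      = id

  saturated-or-large : ∀ l → grow (stage l) ≡ stage l ⊎ l ℕ.≤ ∣ stage l ∣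
  saturated-or-large zero = inj₂ z≤n
  saturated-or-large (suc l) with saturated-or-large l
  ... | inj₁ saturated = inj₁ (cong grow saturated)
  ... | inj₂ large with stage l ⊂ₛ? grow (stage l)
  ...   | yes grows = inj₂ (ℕP.≤-trans (s≤s large) (p⊂q⇒∣p∣<∣q∣ grows))
  ...   | no stuck  = inj₁ (cong grow
    (⊆-antisym (⊆∧⊄⇒⊇ (grow-inflationary _) stuck) (grow-inflationary _)))

  closure : Subset k
  closure = stage (suc k)

  initial⊆closure : initial ⊆ₛ closure
  initial⊆closure = stage-mono {l = suc k} z≤n

  closure-saturated : grow closure ≡ closure
  closure-saturated with saturated-or-large (suc k)
  ... | inj₁ saturated = saturated
  ... | inj₂ large     = ⊥-elim (ℕP.≤⇒≯ (∣p∣≤n closure) large)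

module Stages {n} (N : TripNetwork n) (u : Fin n) where

  open import Data.List.Membership.DecPropositional (FP._≟_ {n}) using (_∈?_)

  stops : Fin (m N) → List (Fin n)
  stops i = nodes (trip N i)

  Meets : Fin (m N) → Fin (m N) → Set
  Meets i j = Any (_∈ stops j) (stops i)

  meets? : ∀ i j → Dec (Meets i j)
  meets? i j = any? (_∈? stops j) (stops i)

  Joins : Subset (m N) → Fin (m N) → Set
  Joins p i = i ∈ₛ p ⊎ ∃ λ j → j ∈ₛ p × Meets i j

  joins? : ∀ p i → Dec (Joins p i)
  joins? p i = i ∈ₛ? p ⊎-dec FP.any? (λ j → j ∈ₛ? p ×-dec meets? i j)

  grow : Subset (m N) → Subset (m N)
  grow p = fromDec (joins? p)

  grow-inflationary : ∀ p → p ⊆ₛ grow p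
  grow-inflationary p i∈ = ∈-fromDec⁺ (joins? p) (inj₁ i∈)

  grow⁺ : ∀ {p i j} → j ∈ₛ p → Meets i j → i ∈ₛ grow p
  grow⁺ {p} j∈ i~j = ∈-fromDec⁺ (joins? p) (inj₂ (_ , j∈ , i~j))

  grow⁻ : ∀ {p i} → i ∈ₛ grow p → Joins p i
  grow⁻ {p} = ∈-fromDec⁻ (joins? p)

  visits-u? : ∀ i → Dec (u ∈ stops i)
  visits-u? i = u ∈? stops i

  open Saturation grow grow-inflationary (fromDec visits-u?) public

  closure-closed : ∀ {i j} → j ∈ₛ closure → Meets i j → i ∈ₛ closure
  closure-closed j∈ i~j = subst (_ ∈ₛ_) closure-saturated (grow⁺ j∈ i~j)

  stage-respects-stops : ∀ {i i′} → stops i ⊆ stops i′ → ∀ l → i ∈ₛ stage l → i′ ∈ₛ stage l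
  stage-respects-stops i⊆i′ zero i∈ =
    ∈-fromDec⁺ visits-u? (i⊆i′ (∈-fromDec⁻ visits-u? i∈))
  stage-respects-stops i⊆i′ (suc l) i∈ with grow⁻ i∈
  ... | inj₁ i∈l            = grow-inflationary _ (stage-respects-stops i⊆i′ l i∈l)
  ... | inj₂ (j , j∈ , i~j) = grow⁺ j∈ (Any-resp-⊆ i⊆i′ i~j)

  misses? : ∀ i (l : Fin (suc (m N))) → Dec (i ∉ₛ stage (toℕ l))
  misses? i l = ¬? (i ∈ₛ? stage (toℕ l))

  missed : Fin (m N) → Subset (suc (m N))
  missed i = fromDec (misses? i)

  -- As the stages increase, this is the index of the first stage containing i
  -- (m N + 1 if there is none).
  rank : Fin (m N) → ℕ
  rank i = ∣ missed i ∣

  rank-< : ∀ {l i j} → l ℕ.< suc (m N) → j ∈ₛ stage l → i ∉ₛ stage l → rank j ℕ.< rank i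
  rank-< {l} {i} {j} l<K j∈ i∉ =
    p⊂q⇒∣p∣<∣q∣ (missed-j⊆missed-i , l′ , ∈-fromDec⁺ (misses? i) i∉l′ , l′∉missed-j)
    where
    l′ : Fin (suc (m N))
    l′ = fromℕ< l<K
    l′≡l : toℕ l′ ≡ l
    l′≡l = FP.toℕ-fromℕ< l<K
    i∉l′ : i ∉ₛ stage (toℕ l′)
    i∉l′ = subst (λ l″ → i ∉ₛ stage l″) (sym l′≡l) i∉
    l′∉missed-j : l′ ∉ₛ missed j
    l′∉missed-j l′∈ = ∈-fromDec⁻ (misses? j) l′∈ (subst (λ l″ → j ∈ₛ stage l″) (sym l′≡l) j∈)
    i∈⇒j∈ : ∀ l″ → i ∈ₛ stage l″ → j ∈ₛ stage l″
    i∈⇒j∈ l″ i∈ with ℕP.≤-total l″ l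
    ... | inj₁ l″≤l = ⊥-elim (i∉ (stage-mono l″≤l i∈))
    ... | inj₂ l≤l″ = stage-mono l≤l″ j∈
    missed-j⊆missed-i : missed j ⊆ₛ missed i
    missed-j⊆missed-i {l″} l″∈ = ∈-fromDec⁺ (misses? i)
      (∈-fromDec⁻ (misses? j) l″∈ ∘ i∈⇒j∈ (toℕ l″))

module Journey {n} (N : TripNetwork n) (σ : Fin (m N) → Fin (m N))
               (σ-reverses : ∀ i → nodes (trip N (σ i)) ≡ reverse (nodes (trip N i)))
               (u : Fin n) where

  open Stages N u

  schedule : Schedule N
  schedule = proj₁ (sortDescending rank)

  schedule-sorted : SortedDescending rank schedule
  schedule-sorted = proj₂ (sortDescending rank)

  τ : Temporalisation N
  τ = τS N schedule

  G : List (TEdge n)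
  G = induced N τ

  finish : Fin (m N) → ℚ
  finish i = τ i + duration (trip N i)

  finish≤start-of-earlier-stage : ∀ {l i j} → l ℕ.< suc (m N) → j ∈ₛ stage l →
                                  i ∉ₛ stage l → finish i ≤ τ j
  finish≤start-of-earlier-stage l<K j∈ i∉ =
    finish≤start N schedule (larger-first {S = schedule} schedule-sorted (rank-< l<K j∈ i∉))

  stops-σ : ∀ i → stops i ⊆ stops (σ i)
  stops-σ i x∈ = subst (_ ∈_) (sym (σ-reverses i)) (reverse⁺ x∈)

  stops-σ⁻ : ∀ i → stops (σ i) ⊆ stops i
  stops-σ⁻ i x∈ = reverse⁻ (subst (_ ∈_) (σ-reverses i) x∈)

  transfer : ∀ {i x y t} → x ∈ stops i → y ∈ stops i →
             TPath G (finish i) y u → TPath G (finish (σ i)) y u →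
             t ≤ τ i → t ≤ τ (σ i) → TPath G t x u
  transfer {i} {x} {y} x∈ y∈ via-i via-σi t≤ t≤σ with precedes-or-reverse x∈ y∈
  ... | inj₁ x≼y = wait G t≤ (ride-trip N τ i x≼y via-i)
  ... | inj₂ x≼y = wait G t≤σ (ride-trip N τ (σ i) x≼y-in-σi via-σi)
    where
    x≼y-in-σi : Precedes (stops (σ i)) x y
    x≼y-in-σi = subst (λ zs → Precedes zs x y) (sym (σ-reverses i)) x≼y

  reaches-u : ∀ l → l ℕ.≤ suc (m N) → ∀ {i x t} → i ∈ₛ stage l → x ∈ stops i →
              t ≤ τ i → t ≤ τ (σ i) → TPath G t x u
  reaches-u zero _ i∈ x∈ = transfer x∈ (∈-fromDec⁻ visits-u? i∈) t-done t-done
  reaches-u (suc l) l<K {i} i∈ x∈ with i ∈ₛ? stage l | grow⁻ i∈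
  ... | yes i∈l | _                   = reaches-u l (ℕP.<⇒≤ l<K) i∈l x∈
  ... | no i∉l  | inj₁ i∈l            = ⊥-elim (i∉l i∈l)
  ... | no i∉l  | inj₂ (j , j∈ , i~j) with find i~j
  ...   | y , y∈i , y∈j = transfer x∈ y∈i (onward i∉l) (onward σi∉l)
    where
    σi∉l : σ i ∉ₛ stage l
    σi∉l = i∉l ∘ stage-respects-stops (stops-σ⁻ i) l
    onward : ∀ {i′} → i′ ∉ₛ stage l → TPath G (finish i′) y u
    onward i′∉ = reaches-u l (ℕP.<⇒≤ l<K) j∈ y∈j
      (finish≤start-of-earlier-stage l<K j∈ i′∉)
      (finish≤start-of-earlier-stage l<K (stage-respects-stops (stops-σ j) l j∈) i′∉)

  OnClosureTrip : Fin n → Set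
  OnClosureTrip x = ∃ λ i → i ∈ₛ closure × x ∈ stops i

  u-on-closure-trip : OnClosureTrip u
  u-on-closure-trip with node-cov N u
  ... | i , u∈ = i , initial⊆closure (∈-fromDec⁺ visits-u? u∈) , u∈

  walk-to-closure-trip : ∀ {v w} → DReach N v w → OnClosureTrip w → OnClosureTrip v
  walk-to-closure-trip d-refl on = on
  walk-to-closure-trip (d-step {e = e} v⇝tl e∈E refl) (i , i∈ , hd∈i)
    with All.lookup (edge-cov N) e∈E
  ... | j , e∈j = walk-to-closure-trip v⇝tl
    (j , closure-closed i∈ (lose (hd∈nodes e∈j) hd∈i) , tl∈nodes (trip-walk N j) e∈j)

  reaches-u-from : ∀ {v} → DReach N v u → SReach N schedule v u
  reaches-u-from v⇝u with walk-to-closure-trip v⇝u u-on-closure-trip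
  ... | i , i∈ , v∈ = 0ℚ , reaches-u (suc (m N)) ℕP.≤-refl i∈ v∈
                             (τS-nonneg N schedule i) (τS-nonneg N schedule (σ i))

fact3 : ∀ {n} (N : TripNetwork n) → Symmetric N → (u : Fin n) →
          Σ (Schedule N) λ S → ∀ (v : Fin n) → DReach N v u → SReach N S v u
fact3 N (σ , _ , _ , σ-reverses) u = schedule , λ _ → reaches-u-from
  where open Journey N σ σ-reverses u
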